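{- Let $G$ be any simple graph on $n$ vertices and let $J$ be the matching with edge set $\{(i,i') : 1\le i\le n\}$. Then $\chi(G^k)=\chi(G)$ for all integers $k\ge 1$; in particular $\chi_\infty(G,J)=\chi(G)$.
   Context: Let $G$ be a simple graph with vertex set $V(G)=\{v_1,\dots,v_n\}$. Let $K_{n,n}$ be the complete bipartite graph with parts $I_n=\{1,\dots,n\}$ and $I_n'=\{1',\dots,n'\}$; a subgraph $J$ of $K_{n,n}$ with vertex set $I_n\cup I_n'$ is symmetric if $i\sim j'$ iff $j\sim i'$. The self-similar graphs based on $(G,J)$: $G^1=G$; for $k\ge2$, $V(G^k)=V(G)^k$, and $(v_{i_1},\dots,v_{i_k})\sim(v_{j_1},\dots,v_{j_k})$ in $G^k$ iff either (1) $(v_{i_1},\dots,v_{i_{k-1}})=(v_{j_1},\dots,v_{j_{k-1}})$ and $v_{i_k}\sim v_{j_k}$ in $G$, or (2) $(v_{i_1},\dots,v_{i_{k-1}})\sim(v_{j_1},\dots,v_{j_{k-1}})$ in $G^{k-1}$ and $i_k\sim j_k'$ in $J$. The sequence $\chi(G^k)$ is non-decreasing; $\chi_\infty(G,J)$ denotes its limit, with $\chi_\infty(G,J)=\infty$ if it is unbounded. -}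

module Defs where

open import Data.Nat using (ℕ; zero; suc; _≤_)
open import Data.Fin using (Fin)
open import Data.Product using (Σ; _×_; _,_)
open import Data.Unit using (⊤)
open import Data.Empty using (⊥)
open import Data.Sum using (_⊎_)
open import Relation.Nullary using (¬_)
open import Relation.Binary.PropositionalEquality using (_≡_; _≢_)

record SimpleGraph (V : Set) : Set₁ where
  field
    Adj   : V → V → Set
    sym   : ∀ {x y} → Adj x y → Adj y x
    loopless : ∀ {x} → ¬ Adj x x
open SimpleGraph public

ProperColouring : {V : Set} → (V → V → Set) → (c : ℕ) → (V → Fin c) → Set
ProperColouring Adj c f = ∀ {x y} → Adj x y → f x ≢ f y

Colourable : {V : Set} → (V → V → Set) → ℕ → Set
Colourable Adj c = Σ _ (ProperColouring Adj c)

IsChromaticNumber : {V : Set} → (V → V → Set) → ℕ → Set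
IsChromaticNumber Adj c = Colourable Adj c × (∀ d → Colourable Adj d → c ≤ d)

-- A subgraph J of K_{n,n}, given by the relation  i ∼ j'  ; symmetric if
-- i ∼ j' iff j ∼ i'.
BipRel : ℕ → Set₁
BipRel n = Fin n → Fin n → Set

IsSymmetricBip : {n : ℕ} → BipRel n → Set
IsSymmetricBip J = ∀ i j → (J i j → J j i) × (J j i → J i j)

Matching : (n : ℕ) → BipRel n
Matching n i j = i ≡ j

-- Vertices of G^k are k-tuples (v_{i_1},...,v_{i_k}); stored as nested
-- pairs ((...(v_{i_1}, v_{i_2}), ...), v_{i_k}).  Only k ≥ 1 is used;
-- Tuple 0 is a dummy.
Tuple : ℕ → ℕ → Set
Tuple n zero = ⊤
Tuple n (suc zero) = Fin n
Tuple n (suc (suc k)) = Tuple n (suc k) × Fin n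

SSAdj : {n : ℕ} → SimpleGraph (Fin n) → BipRel n → (k : ℕ) →
        Tuple n k → Tuple n k → Set
SSAdj G J zero x y = ⊥
SSAdj G J (suc zero) x y = Adj G x y
SSAdj G J (suc (suc k)) (u , a) (w , b) =
  (u ≡ w × Adj G a b) ⊎ (SSAdj G J (suc k) u w × J a b)

-- Colour the tuple (v₁, …, vₖ) by the sum of the colours of its entries
-- modulo c.  Two tuples adjacent through the matching share their last entry
-- and have adjacent prefixes; two tuples adjacent inside a copy of G share
-- their prefix and have adjacent last entries.  Either way cancellation in
-- ℤ/c separates their colours, so c colours suffice.  Conversely G^k
-- contains a copy of G (fix every coordinate but the last), so it needs at
-- least χ(G) colours.
module Submission where

open import Defs hiding (sym)
open import Data.Nat using (ℕ; zero; suc; _+_; _∸_; _%_; _<_; _≤_; NonZero)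
open import Data.Nat.Properties using (+-comm; +-assoc; m∸n+n≡m; <⇒≤)
open import Data.Nat.DivMod using (_mod_; %-distribˡ-+; [m+n]%n≡m%n; m<n⇒m%n≡m)
open import Data.Fin using (Fin; toℕ)
import Data.Fin as Fin
open import Data.Fin.Properties using (toℕ-fromℕ<; toℕ-injective; toℕ<n)
open import Data.Product using (_,_)
open import Data.Sum using (inj₁; inj₂)
open import Relation.Binary.PropositionalEquality
  using (_≡_; refl; cong; sym; trans; module ≡-Reasoning)

+-%-cancelˡ : ∀ {a x y} c .{{_ : NonZero c}} → a ≤ c → x < c → y < c →
              (a + x) % c ≡ (a + y) % c → x ≡ y
+-%-cancelˡ {a} {x} {y} c a≤c x<c y<c eq = begin
  x                               ≡⟨ subtract-a x<c ⟨
  (c ∸ a + (a + x)) % c           ≡⟨ %-distribˡ-+ (c ∸ a) (a + x) c ⟩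
  ((c ∸ a) % c + (a + x) % c) % c ≡⟨ cong (λ r → ((c ∸ a) % c + r) % c) eq ⟩
  ((c ∸ a) % c + (a + y) % c) % c ≡⟨ %-distribˡ-+ (c ∸ a) (a + y) c ⟨
  (c ∸ a + (a + y)) % c           ≡⟨ subtract-a y<c ⟩
  y                               ∎
  where
  open ≡-Reasoning
  subtract-a : ∀ {z} → z < c → (c ∸ a + (a + z)) % c ≡ z
  subtract-a {z} z<c = begin
    (c ∸ a + (a + z)) % c ≡⟨ cong (_% c) (+-assoc (c ∸ a) a z) ⟨
    (c ∸ a + a + z) % c   ≡⟨ cong (λ m → (m + z) % c) (m∸n+n≡m a≤c) ⟩
    (c + z) % c           ≡⟨ cong (_% c) (+-comm c z) ⟩
    (z + c) % c           ≡⟨ [m+n]%n≡m%n z c ⟩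
    z % c                 ≡⟨ m<n⇒m%n≡m z<c ⟩
    z                     ∎

infixl 6 _⊕_

_⊕_ : ∀ {c} → Fin c → Fin c → Fin c
_⊕_ {suc c} i j = (toℕ i + toℕ j) mod suc c

⊕-comm : ∀ {c} (i j : Fin c) → i ⊕ j ≡ j ⊕ i
⊕-comm {suc c} i j = cong (_mod suc c) (+-comm (toℕ i) (toℕ j))

⊕-cancelˡ : ∀ {c} (i : Fin c) {j k : Fin c} → i ⊕ j ≡ i ⊕ k → j ≡ k
⊕-cancelˡ {suc c} i {j} {k} eq = toℕ-injective
  (+-%-cancelˡ (suc c) (<⇒≤ (toℕ<n i)) (toℕ<n j) (toℕ<n k) (begin
    (toℕ i + toℕ j) % suc c ≡⟨ toℕ-fromℕ< _ ⟨
    toℕ (i ⊕ j)             ≡⟨ cong toℕ eq ⟩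
    toℕ (i ⊕ k)             ≡⟨ toℕ-fromℕ< _ ⟩
    (toℕ i + toℕ k) % suc c ∎))
  where open ≡-Reasoning

⊕-cancelʳ : ∀ {c} (k : Fin c) {i j : Fin c} → i ⊕ k ≡ j ⊕ k → i ≡ j
⊕-cancelʳ k {i} {j} eq =
  ⊕-cancelˡ k (trans (⊕-comm k i) (trans eq (⊕-comm j k)))

colourable-pullback : ∀ {V W : Set} {A : V → V → Set} {B : W → W → Set} {d}
  (h : V → W) → (∀ {x y} → A x y → B (h x) (h y)) →
  Colourable B d → Colourable A d
colourable-pullback h hom (f , proper) = (λ x → f (h x)) , (λ adj → proper (hom adj))

module _ {n : ℕ} (G : SimpleGraph (Fin n)) (J : BipRel n) where

  fibre : Fin n → (k : ℕ) → Fin n → Tuple n (suc k)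
  fibre z zero    a = a
  fibre z (suc k) a = fibre z k z , a

  fibre-homomorphism : ∀ z k {a b} → Adj G a b → SSAdj G J (suc k) (fibre z k a) (fibre z k b)
  fibre-homomorphism z zero    adj = adj
  fibre-homomorphism z (suc k) adj = inj₁ (refl , adj)

power-colourable⇒colourable : ∀ {n} (G : SimpleGraph (Fin n)) (J : BipRel n) k {d} →
  Colourable (SSAdj G J (suc k)) d → Colourable (Adj G) d
power-colourable⇒colourable {zero}  G J k _ = (λ ()) , λ { {()} }
power-colourable⇒colourable {suc _} G J k =
  colourable-pullback (fibre G J Fin.zero k) (fibre-homomorphism G J Fin.zero k)

module _ {n : ℕ} (G : SimpleGraph (Fin n)) (J : BipRel n) where

  sumColouring : ∀ {c} → (Fin n → Fin c) → (k : ℕ) → Tuple n (suc k) → Fin c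
  sumColouring g zero    a       = g a
  sumColouring g (suc k) (u , a) = sumColouring g k u ⊕ g a

  sumColouring-proper : ∀ {c} {g : Fin n → Fin c} →
    ProperColouring (Adj G) c g → (∀ {a b} → J a b → g a ≡ g b) →
    ∀ k → ProperColouring (SSAdj G J (suc k)) c (sumColouring g k)
  sumColouring-proper proper J-monochromatic zero adj = proper adj
  sumColouring-proper {g = g} proper J-monochromatic (suc k) {u , a} {w , b} = λ where
    (inj₁ (refl , adj)) eq → proper adj (⊕-cancelˡ (sumColouring g k u) eq)
    (inj₂ (adj , ab))   eq → sumColouring-proper proper J-monochromatic k adj
      (⊕-cancelʳ (g a) (trans eq (cong (sumColouring g k w ⊕_) (sym (J-monochromatic ab)))))

theorem3p1 : (n : ℕ) (G : SimpleGraph (Fin n)) (c : ℕ) →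
    IsChromaticNumber (Adj G) c →
    (k : ℕ) → 1 ≤ k → IsChromaticNumber (SSAdj G (Matching n) k) c
theorem3p1 n G c ((g , proper) , minimal) (suc k) _ =
  (sumColouring G J g k , sumColouring-proper G J proper (cong g) k) ,
  λ d colourable → minimal d (power-colourable⇒colourable G J k colourable)
  where J = Matching n
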